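{- Let $\Phi=\bigwedge_{i=1}^m f_i\mid g_i$ be a system of divisibility constraints in $d$ variables with the elimination property for an order $\prec$. Then (i) $|\Delta(\Phi)|\le 2m^2(d+2)$, and (ii) $\langle\|\Delta(\Phi)\|_\infty\rangle\le(d+2)\cdot(\langle\|\Phi\|_\infty\rangle+1)$.
   Context: Linear polynomials have integer coefficients and constants; primitive means non-zero with gcd of coefficients and constant equal to $1$; the primitive part of non-zero $g$ is the primitive $f$ with $g=\gcd(g)f$. A system of divisibility constraints is $\bigwedge_i f_i\mid g_i$ with linear $f_i\ne0$; $\mathrm{terms}(\Phi)=\{f_i,g_i\}$. For a finite set $X$ of polynomials, $\|X\|_\infty$ is the maximum absolute value of a coefficient or constant of an element of $X$, $\|\Phi\|_\infty=\|\mathrm{terms}(\Phi)\|_\infty$, and $\langle a\rangle=1+\lceil\log_2(|a|+1)\rceil$. For an order $x_1\prec\dots\prec x_d$, $\mathrm{lv}(f)$ is the $\prec$-largest variable with non-zero coefficient ($\bot$ if constant, $\bot\prec x_i$, $x_0:=\bot$); $\mathbb{Z}[x_1,\dots,x_k]$ denotes linear polynomials in $x_1,\dots,x_k$. The divisibility module $M_f(\Phi)$ of primitive $f$ is the smallest set of linear polynomials containing $f$, closed under integer linear combinations, such that if $g\mid h$ is in $\Phi$ and $bg\in M_f(\Phi)$ then $bh\in M_f(\Phi)$. Elimination property for $\prec$: for every primitive part $f$ of a left-hand side and every $0\le k\le d$, $\{g:\mathrm{lv}(g)\preceq x_k,\ f\mid g\text{ appears in }\Phi\}$ is linearly independent and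 a basis of $M_f(\Phi)\cap\mathbb{Z}[x_1,\dots,x_k]$. S-polynomial: if $\mathrm{lv}(f)=x_l$, $\mathrm{lv}(g)=x_k$, $S(f,g)=b_kf-a_lg$ with $a_l$ the coefficient of $x_l$ in $f$, $b_k$ that of $x_k$ in $g$ (if $f$ constant, $a_l:=f$; if $g$ constant, $b_k:=g$). For primitive $f$, $\Delta_f(\Phi)$ is the smallest set with $\mathrm{terms}(\Phi)\subseteq\Delta_f(\Phi)$ such that if $f\mid g$ occurs in $\Phi$ and $h\in\Delta_f(\Phi)$ with $\mathrm{lv}(g)=\mathrm{lv}(h)$ then $S(g,h)\in\Delta_f(\Phi)$; $\Delta(\Phi)$ is the union of $\Delta_f(\Phi)$ over all primitive parts $f$ of polynomials in $\mathrm{terms}(\Phi)$. -}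

module Defs where

open import Data.Nat as ℕ using (ℕ; zero; suc; _⊔_)
open import Data.Nat.GCD using (gcd)
open import Data.Nat.Logarithm using (⌈log₂_⌉)
open import Data.Integer as ℤ using (ℤ; ∣_∣; 0ℤ)
open import Data.Vec as Vec using (Vec; []; _∷_; replicate; zipWith; map; foldr)
open import Data.List as List using (List; concatMap; length)
open import Data.List.Membership.Propositional using (_∈_)
open import Data.List.Relation.Unary.All using (All)
open import Data.List.Relation.Unary.Unique.Propositional using (Unique)
open import Data.Product using (_×_; _,_; proj₁; proj₂; Σ; ∃; ∃-syntax)
open import Data.Bool using (if_then_else_)
open import Relation.Nullary using (¬_)
open import Relation.Nullary.Decidable using (⌊_⌋)
open import Relation.Binary.PropositionalEquality using (_≡_; _≢_)

-- Linear polynomials a₁x₁ + … + a_d x_d + c over ℤ in d variables.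
-- coe holds (a₁,…,a_d) (head = coefficient of x₁), cst the constant.

record LinPoly (d : ℕ) : Set where
  constructor lin
  field
    coe : Vec ℤ d
    cst : ℤ
open LinPoly public

0P : ∀ {d} → LinPoly d
0P = lin (replicate _ 0ℤ) 0ℤ

_+P_ : ∀ {d} → LinPoly d → LinPoly d → LinPoly d
f +P g = lin (zipWith ℤ._+_ (coe f) (coe g)) (cst f ℤ.+ cst g)

_·P_ : ∀ {d} → ℤ → LinPoly d → LinPoly d
a ·P f = lin (map (a ℤ.*_) (coe f)) (a ℤ.* cst f)

_-P_ : ∀ {d} → LinPoly d → LinPoly d → LinPoly d
f -P g = f +P (ℤ.-_ (ℤ.+ 1) ·P g)

content : ∀ {d} → LinPoly d → ℕ
content f = foldr _ (λ a r → gcd ∣ a ∣ r) ∣ cst f ∣ (coe f)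

Primitive : ∀ {d} → LinPoly d → Set
Primitive f = f ≢ 0P × content f ≡ 1

IsPrimPart : ∀ {d} → LinPoly d → LinPoly d → Set
IsPrimPart f g = g ≢ 0P × Primitive f × g ≡ (ℤ.+ content g) ·P f

-- Leading variable w.r.t. x₁ ≺ … ≺ x_d, encoded in ℕ:
-- 0 encodes ⊥ (constant polynomial), k ≥ 1 encodes x_k.

lvVec : ∀ {n} → Vec ℤ n → ℕ
lvVec []      = 0
lvVec (a ∷ v) with lvVec v
... | zero  = if ⌊ a ℤ.≟ 0ℤ ⌋ then 0 else 1
... | suc k = suc (suc k)

lv : ∀ {d} → LinPoly d → ℕ
lv f = lvVec (coe f)

lcVec : ∀ {n} → Vec ℤ n → ℤ
lcVec []      = 0ℤ
lcVec (a ∷ v) with lvVec v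
... | zero  = a
... | suc _ = lcVec v

lc : ∀ {d} → LinPoly d → ℤ
lc f with lv f
... | zero  = cst f
... | suc _ = lcVec (coe f)

Spol : ∀ {d} → LinPoly d → LinPoly d → LinPoly d
Spol f g = (lc g ·P f) -P (lc f ·P g)

-- Systems of divisibility constraints ⋀ f_i ∣ g_i : list of pairs (f_i , g_i)

System : ℕ → Set
System d = List (LinPoly d × LinPoly d)

WellFormed : ∀ {d} → System d → Set
WellFormed Φ = All (λ p → proj₁ p ≢ 0P) Φ

terms : ∀ {d} → System d → List (LinPoly d)
terms = concatMap (λ p → proj₁ p List.∷ proj₂ p List.∷ List.[])

normP : ∀ {d} → LinPoly d → ℕ
normP f = foldr _ (λ a r → ∣ a ∣ ⊔ r) ∣ cst f ∣ (coe f)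

normL : ∀ {d} → List (LinPoly d) → ℕ
normL = List.foldr (λ f r → normP f ⊔ r) 0

normΦ : ∀ {d} → System d → ℕ
normΦ Φ = normL (terms Φ)

-- bit size ⟨a⟩ = 1 + ⌈log₂(|a|+1)⌉ (argument given as |a|)
⟨_⟩ : ℕ → ℕ
⟨ a ⟩ = 1 ℕ.+ ⌈log₂ (a ℕ.+ 1) ⌉

data M {d} (Φ : System d) (f : LinPoly d) : LinPoly d → Set where
  gen   : M Φ f f
  zero  : M Φ f 0P
  add   : ∀ {g h} → M Φ f g → M Φ f h → M Φ f (g +P h)
  scale : ∀ {g} (c : ℤ) → M Φ f g → M Φ f (c ·P g)
  div   : ∀ {g h} (b : ℤ) → (g , h) ∈ Φ → M Φ f (b ·P g) → M Φ f (b ·P h)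

lincomb : ∀ {d} → List (ℤ × LinPoly d) → LinPoly d
lincomb = List.foldr (λ p r → (proj₁ p ·P proj₂ p) +P r) 0P

LinIndep : ∀ {d} → (LinPoly d → Set) → Set
LinIndep {d} S = ∀ (L : List (ℤ × LinPoly d)) → All (λ p → S (proj₂ p)) L →
  Unique (List.map proj₂ L) → lincomb L ≡ 0P → All (λ p → proj₁ p ≡ 0ℤ) L

IsBasis : ∀ {d} → (LinPoly d → Set) → (LinPoly d → Set) → Set
IsBasis {d} S T = LinIndep S × (∀ g → S g → T g) ×
  (∀ h → T h → ∃[ L ] (All (λ p → S (proj₂ p)) L × lincomb L ≡ h))

ElimProp : ∀ {d} → System d → Set
ElimProp {d} Φ = ∀ (f : LinPoly d) →
  (∃[ p ] (p ∈ Φ × IsPrimPart f (proj₁ p))) →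
  ∀ (k : ℕ) → k ℕ.≤ d →
  IsBasis (λ g → lv g ℕ.≤ k × (f , g) ∈ Φ) (λ h → M Φ f h × lv h ℕ.≤ k)

data Δf {d} (Φ : System d) (f : LinPoly d) : LinPoly d → Set where
  base : ∀ {h} → h ∈ terms Φ → Δf Φ f h
  step : ∀ {g h} → (f , g) ∈ Φ → Δf Φ f h → lv g ≡ lv h → Δf Φ f (Spol g h)

Δ : ∀ {d} → System d → LinPoly d → Set
Δ {d} Φ h = ∃[ f ] ((∃[ t ] (t ∈ terms Φ × IsPrimPart f t)) × Δf Φ f h)

{-# OPTIONS --safe #-}
-- Every h ∈ Δ_f(Φ) is reached from a term t of Φ by S-polynomial steps S(g, ·) with
-- f ∣ g in Φ and lv g equal to the current leading variable. Each step lowers the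
-- leading variable, a step at level ⊥ yields 0, and a step multiplies the norm by at
-- most 2‖Φ‖; so ‖h‖ ≤ ‖Φ‖(2‖Φ‖)^d, which gives (ii). For (i), the elimination property
-- makes the right-hand side of f at each level unique, so h is among the first d + 2
-- elements of the chain determined by f and t: at most m · 2m · (d + 2) candidates.

module Submission where

open import Defs
open import Data.Bool using (if_then_else_)
open import Data.Empty using (⊥-elim)
open import Data.Fin using (Fin; zero; suc)
open import Data.Integer as ℤ using (ℤ; ∣_∣; 0ℤ; -1ℤ)
import Data.Integer.Properties as ℤP
open import Data.Integer.Tactic.RingSolver using () renaming (solve-∀ to ℤ-solve)
open import Data.List as List using (List; []; _∷_; length; concatMap; applyUpTo)
import Data.List.Properties as ListP
open import Data.List.Membership.Propositional using (_∈_; find)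
open import Data.List.Membership.Propositional.Properties using (∈-concatMap⁺; ∈-concatMap⁻)
open import Data.List.Relation.Unary.All as All using (All; []; _∷_)
import Data.List.Relation.Unary.All.Properties as AllP
open import Data.List.Relation.Unary.Any as Any using (here; there)
open import Data.List.Relation.Unary.AllPairs using ([]; _∷_)
open import Data.List.Relation.Unary.Unique.Propositional using (Unique)
open import Data.Nat as ℕ using (ℕ; zero; suc; _+_; _*_; _^_; _≤_; _<_; _⊔_; z≤n; s≤s)
import Data.Nat.Properties as ℕP
open import Data.Nat.GeneralisedArithmetic using (fold)
open import Data.Nat.Logarithm using (⌈log₂_⌉; ⌈log₂⌉-mono-≤; ⌈log₂2^n⌉≡n)
open import Data.Nat.Logarithm.Core using (⌈log2⌉)
open import Data.Nat.Tactic.RingSolver using () renaming (solve-∀ to ℕ-solve)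
open import Data.Product using (_×_; _,_; proj₁; proj₂; ∃-syntax)
open import Data.Sum using (_⊎_; inj₁; inj₂; [_,_])
open import Data.Vec as Vec using (Vec; []; _∷_; replicate; zipWith; map; lookup)
import Data.Vec.Properties as VecP
open import Function using (_∘_)
open import Induction.WellFounded using (Acc; acc)
open import Relation.Binary.Definitions using (DecidableEquality)
open import Relation.Nullary using (yes; no)
open import Relation.Nullary.Decidable using (⌊_⌋; map′; _×-dec_)
open import Relation.Binary.PropositionalEquality
  using (_≡_; _≢_; refl; sym; trans; cong; cong₂; subst; module ≡-Reasoning)

private variable
  d n k : ℕ

coeff : LinPoly d → Fin (suc d) → ℤ
coeff f zero    = cst f
coeff f (suc i) = lookup (coe f) i

coeff-injective : ∀ {f g : LinPoly d} → (∀ i → coeff f i ≡ coeff g i) → f ≡ g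
coeff-injective {f = lin u a} {lin v b} eq = cong₂ lin u≡v (eq zero)
  where
  u≡v : u ≡ v
  u≡v = trans (sym (VecP.tabulate∘lookup u))
          (trans (VecP.tabulate-cong (eq ∘ suc)) (VecP.tabulate∘lookup v))

coeff-+P : ∀ (f g : LinPoly d) i → coeff (f +P g) i ≡ coeff f i ℤ.+ coeff g i
coeff-+P f g zero    = refl
coeff-+P f g (suc i) = VecP.lookup-zipWith ℤ._+_ i (coe f) (coe g)

coeff-·P : ∀ a (f : LinPoly d) i → coeff (a ·P f) i ≡ a ℤ.* coeff f i
coeff-·P a f zero    = refl
coeff-·P a f (suc i) = VecP.lookup-map i (a ℤ.*_) (coe f)

coeff-0P : ∀ (i : Fin (suc d)) → coeff 0P i ≡ 0ℤ
coeff-0P zero    = refl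
coeff-0P (suc i) = VecP.lookup-replicate i 0ℤ

coeff-Spol : ∀ (f g : LinPoly d) i →
  coeff (Spol f g) i ≡ lc g ℤ.* coeff f i ℤ.- lc f ℤ.* coeff g i
coeff-Spol f g i = begin
  coeff (Spol f g) i
    ≡⟨ coeff-+P (lc g ·P f) (-1ℤ ·P (lc f ·P g)) i ⟩
  coeff (lc g ·P f) i ℤ.+ coeff (-1ℤ ·P (lc f ·P g)) i
    ≡⟨ cong₂ ℤ._+_ (coeff-·P (lc g) f i)
         (trans (coeff-·P -1ℤ (lc f ·P g) i) (cong (-1ℤ ℤ.*_) (coeff-·P (lc f) g i))) ⟩
  lc g ℤ.* coeff f i ℤ.+ -1ℤ ℤ.* (lc f ℤ.* coeff g i)
    ≡⟨ cong (ℤ._+_ (lc g ℤ.* coeff f i)) (ℤP.-1*i≡-i (lc f ℤ.* coeff g i)) ⟩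
  lc g ℤ.* coeff f i ℤ.- lc f ℤ.* coeff g i ∎
  where open ≡-Reasoning

+P-assoc : ∀ (f g h : LinPoly d) → (f +P g) +P h ≡ f +P (g +P h)
+P-assoc f g h = cong₂ lin (VecP.zipWith-assoc ℤP.+-assoc (coe f) (coe g) (coe h))
                           (ℤP.+-assoc (cst f) (cst g) (cst h))

+P-comm : ∀ (f g : LinPoly d) → f +P g ≡ g +P f
+P-comm f g = cong₂ lin (VecP.zipWith-comm ℤP.+-comm (coe f) (coe g)) (ℤP.+-comm (cst f) (cst g))

·P-distribʳ-+ : ∀ a b (f : LinPoly d) → (a ℤ.+ b) ·P f ≡ (a ·P f) +P (b ·P f)
·P-distribʳ-+ a b f = coeff-injective λ i → begin
  coeff ((a ℤ.+ b) ·P f) i                ≡⟨ coeff-·P (a ℤ.+ b) f i ⟩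
  (a ℤ.+ b) ℤ.* coeff f i                 ≡⟨ ℤP.*-distribʳ-+ (coeff f i) a b ⟩
  a ℤ.* coeff f i ℤ.+ b ℤ.* coeff f i     ≡⟨ cong₂ ℤ._+_ (coeff-·P a f i) (coeff-·P b f i) ⟨
  coeff (a ·P f) i ℤ.+ coeff (b ·P f) i   ≡⟨ coeff-+P (a ·P f) (b ·P f) i ⟨
  coeff ((a ·P f) +P (b ·P f)) i          ∎
  where open ≡-Reasoning

+P-identityʳ : ∀ (f : LinPoly d) → f +P 0P ≡ f
+P-identityʳ f = cong₂ lin (VecP.zipWith-identityʳ ℤP.+-identityʳ (coe f)) (ℤP.+-identityʳ (cst f))

·P-identityˡ : ∀ (f : LinPoly d) → (ℤ.+ 1) ·P f ≡ f
·P-identityˡ f = cong₂ lin (trans (VecP.map-cong ℤP.*-identityˡ (coe f)) (VecP.map-id (coe f)))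
                           (ℤP.*-identityˡ (cst f))

Spol-cancels : ∀ (g h : LinPoly d) → (lc g ·P h) +P (((ℤ.- lc h) ·P g) +P Spol g h) ≡ 0P
Spol-cancels g h = coeff-injective λ i → begin
  coeff ((lc g ·P h) +P (((ℤ.- lc h) ·P g) +P Spol g h)) i
    ≡⟨ coeff-+P (lc g ·P h) _ i ⟩
  coeff (lc g ·P h) i ℤ.+ coeff (((ℤ.- lc h) ·P g) +P Spol g h) i
    ≡⟨ cong (ℤ._+_ (coeff (lc g ·P h) i)) (coeff-+P ((ℤ.- lc h) ·P g) (Spol g h) i) ⟩
  coeff (lc g ·P h) i ℤ.+ (coeff ((ℤ.- lc h) ·P g) i ℤ.+ coeff (Spol g h) i)
    ≡⟨ cong₂ (λ a b → a ℤ.+ (b ℤ.+ coeff (Spol g h) i))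
         (coeff-·P (lc g) h i) (coeff-·P (ℤ.- lc h) g i) ⟩
  lc g ℤ.* coeff h i ℤ.+ (ℤ.- lc h ℤ.* coeff g i ℤ.+ coeff (Spol g h) i)
    ≡⟨ cong (λ s → lc g ℤ.* coeff h i ℤ.+ (ℤ.- lc h ℤ.* coeff g i ℤ.+ s)) (coeff-Spol g h i) ⟩
  lc g ℤ.* coeff h i ℤ.+ (ℤ.- lc h ℤ.* coeff g i ℤ.+ (lc h ℤ.* coeff g i ℤ.- lc g ℤ.* coeff h i))
    ≡⟨ cancel (lc g) (lc h) (coeff g i) (coeff h i) ⟩
  0ℤ
    ≡⟨ coeff-0P i ⟨
  coeff 0P i ∎
  where
  open ≡-Reasoning
  cancel : ∀ a b x y → a ℤ.* y ℤ.+ (ℤ.- b ℤ.* x ℤ.+ (b ℤ.* x ℤ.- a ℤ.* y)) ≡ 0ℤ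
  cancel = ℤ-solve

indicator : ℤ → ℕ
indicator a = if ⌊ a ℤ.≟ 0ℤ ⌋ then 0 else 1

indicator≤1 : ∀ a → indicator a ≤ 1
indicator≤1 a with a ℤ.≟ 0ℤ
... | yes _ = z≤n
... | no _  = s≤s z≤n

indicator≡0⇒≡0 : ∀ {a} → indicator a ≡ 0 → a ≡ 0ℤ
indicator≡0⇒≡0 {a} eq with a ℤ.≟ 0ℤ
... | yes a≡0 = a≡0
... | no _    = ⊥-elim (ℕP.1+n≢0 eq)

indicator-* : ∀ {a} → a ≢ 0ℤ → ∀ x → indicator (a ℤ.* x) ≡ indicator x
indicator-* {a} a≢0 x with x ℤ.≟ 0ℤ
... | yes refl rewrite ℤP.*-zeroʳ a = refl
... | no x≢0 with a ℤ.* x ℤ.≟ 0ℤ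
...   | yes ax≡0 = ⊥-elim ([ a≢0 , x≢0 ] (ℤP.i*j≡0⇒i≡0∨j≡0 a ax≡0))
...   | no _     = refl

lvVec≤length : ∀ (v : Vec ℤ n) → lvVec v ≤ n
lvVec≤length []      = z≤n
lvVec≤length (a ∷ v) with lvVec v | lvVec≤length v
... | zero  | _    = ℕP.≤-trans (indicator≤1 a) (s≤s z≤n)
... | suc _ | k≤n  = s≤s k≤n

lvVec-replicate : ∀ n → lvVec (replicate n 0ℤ) ≡ 0
lvVec-replicate zero    = refl
lvVec-replicate (suc n) rewrite lvVec-replicate n = refl

lvVec≡0⇒≡replicate : ∀ (v : Vec ℤ n) → lvVec v ≡ 0 → v ≡ replicate n 0ℤ
lvVec≡0⇒≡replicate []      _  = refl
lvVec≡0⇒≡replicate (a ∷ v) eq with lvVec v in eqᵥ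
... | zero  = cong₂ _∷_ (indicator≡0⇒≡0 eq) (lvVec≡0⇒≡replicate v eqᵥ)
... | suc _ = ⊥-elim (ℕP.1+n≢0 eq)

lvVec≡suc⇒lcVec≢0 : ∀ (v : Vec ℤ n) → lvVec v ≡ suc k → lcVec v ≢ 0ℤ
lvVec≡suc⇒lcVec≢0 (a ∷ v) eq with lvVec v in eqᵥ
... | zero  = λ a≡0 → ℕP.0≢1+n (trans (cong indicator (sym a≡0)) eq)
... | suc _ = lvVec≡suc⇒lcVec≢0 v eqᵥ

lvVec-map-* : ∀ {a} → a ≢ 0ℤ → (v : Vec ℤ n) → lvVec (map (a ℤ.*_) v) ≡ lvVec v
lvVec-map-* a≢0 []      = refl
lvVec-map-* {a = a} a≢0 (x ∷ v) with lvVec (map (a ℤ.*_) v) | lvVec v | lvVec-map-* a≢0 v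
... | zero  | _ | refl = indicator-* a≢0 x
... | suc _ | _ | refl = refl

lcVec-map-* : ∀ {a} → a ≢ 0ℤ → (v : Vec ℤ n) → lcVec (map (a ℤ.*_) v) ≡ a ℤ.* lcVec v
lcVec-map-* {a = a} a≢0 []      = sym (ℤP.*-zeroʳ a)
lcVec-map-* {a = a} a≢0 (x ∷ v) with lvVec (map (a ℤ.*_) v) | lvVec v | lvVec-map-* a≢0 v
... | zero  | _ | refl = refl
... | suc _ | _ | refl = lcVec-map-* a≢0 v

lvVec-∷≤ : ∀ x (v : Vec ℤ n) → lvVec (x ∷ v) ≤ suc (lvVec v)
lvVec-∷≤ x v with lvVec v
... | zero  = indicator≤1 x
... | suc _ = ℕP.≤-refl

lvVec-zipWith-cancel : ∀ (u v : Vec ℤ n) → lvVec u ≡ suc k → lvVec v ≡ suc k →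
  lcVec u ℤ.+ lcVec v ≡ 0ℤ → lvVec (zipWith ℤ._+_ u v) ≤ k
lvVec-zipWith-cancel {suc n} {k} (x ∷ u) (y ∷ v) eqᵤ eqᵥ cancel
  with lvVec u in eqᵤ′ | lvVec v in eqᵥ′
... | zero | zero = subst (_≤ k) (sym head≡0) z≤n
  where
  tail≡0 : lvVec (zipWith ℤ._+_ u v) ≡ 0
  tail≡0 = begin
    lvVec (zipWith ℤ._+_ u v)
      ≡⟨ cong₂ (λ p q → lvVec (zipWith ℤ._+_ p q)) (lvVec≡0⇒≡replicate u eqᵤ′) (lvVec≡0⇒≡replicate v eqᵥ′) ⟩
    lvVec (zipWith ℤ._+_ (replicate n 0ℤ) (replicate n 0ℤ))
      ≡⟨ cong lvVec (VecP.zipWith-replicate {n = n} ℤ._+_ 0ℤ 0ℤ) ⟩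
    lvVec (replicate n 0ℤ)
      ≡⟨ lvVec-replicate n ⟩
    0 ∎
    where open ≡-Reasoning
  head≡0 : lvVec (x ℤ.+ y ∷ zipWith ℤ._+_ u v) ≡ 0
  head≡0 rewrite tail≡0 | cancel = refl
... | zero  | suc _ = ⊥-elim (ℕP.<⇒≱ (s≤s (s≤s z≤n)) (subst (_≤ 1) (trans eqᵤ (sym eqᵥ)) (indicator≤1 x)))
... | suc _ | zero  = ⊥-elim (ℕP.<⇒≱ (s≤s (s≤s z≤n)) (subst (_≤ 1) (trans eqᵥ (sym eqᵤ)) (indicator≤1 y)))
... | suc _ | suc _ with ℕP.suc-injective eqᵤ | ℕP.suc-injective eqᵥ
...   | refl | refl = ℕP.≤-trans (lvVec-∷≤ (x ℤ.+ y) (zipWith ℤ._+_ u v))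
                                 (s≤s (lvVec-zipWith-cancel u v eqᵤ′ eqᵥ′ cancel))

lv≤ : ∀ (f : LinPoly d) → lv f ≤ d
lv≤ f = lvVec≤length (coe f)

lv≡suc⇒< : ∀ (f : LinPoly d) → lv f ≡ suc k → k < d
lv≡suc⇒< f eq = subst (_≤ _) eq (lv≤ f)

lv-0P : lv (0P {d}) ≡ 0
lv-0P {d} = lvVec-replicate d

lc≡lcVec : ∀ (f : LinPoly d) → lv f ≡ suc k → lc f ≡ lcVec (coe f)
lc≡lcVec f eq rewrite eq = refl

lc≡cst : ∀ (f : LinPoly d) → lv f ≡ 0 → lc f ≡ cst f
lc≡cst f eq rewrite eq = refl

lc≢0 : ∀ {f : LinPoly d} → f ≢ 0P → lc f ≢ 0ℤ
lc≢0 {f = f} f≢0 with lv f in eq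
... | zero  = λ c≡0 → f≢0 (cong₂ lin (lvVec≡0⇒≡replicate (coe f) eq) c≡0)
... | suc _ = lvVec≡suc⇒lcVec≢0 (coe f) eq

lv≡suc⇒lc≢0 : ∀ (f : LinPoly d) → lv f ≡ suc k → lc f ≢ 0ℤ
lv≡suc⇒lc≢0 f eq rewrite lc≡lcVec f eq = lvVec≡suc⇒lcVec≢0 (coe f) eq

lv-Spol-< : ∀ (g h : LinPoly d) → lv g ≡ suc k → lv h ≡ suc k → lv (Spol g h) ≤ k
lv-Spol-< g h eqg eqh =
  lvVec-zipWith-cancel (map (lc h ℤ.*_) (coe g)) (map (-1ℤ ℤ.*_) (map (lc g ℤ.*_) (coe h)))
    (trans (lvVec-map-* lch≢0 (coe g)) eqg)
    (trans (lvVec-map-* -1≢0 (map (lc g ℤ.*_) (coe h))) (trans (lvVec-map-* lcg≢0 (coe h)) eqh))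
    cancel
  where
  -1≢0 : -1ℤ ≢ 0ℤ
  -1≢0 ()
  lcg≢0 : lc g ≢ 0ℤ
  lcg≢0 = lv≡suc⇒lc≢0 g eqg
  lch≢0 : lc h ≢ 0ℤ
  lch≢0 = lv≡suc⇒lc≢0 h eqh
  cancel : lcVec (map (lc h ℤ.*_) (coe g)) ℤ.+ lcVec (map (-1ℤ ℤ.*_) (map (lc g ℤ.*_) (coe h))) ≡ 0ℤ
  cancel = begin
    lcVec (map (lc h ℤ.*_) (coe g)) ℤ.+ lcVec (map (-1ℤ ℤ.*_) (map (lc g ℤ.*_) (coe h)))
      ≡⟨ cong₂ ℤ._+_ (lcVec-map-* lch≢0 (coe g))
           (trans (lcVec-map-* -1≢0 (map (lc g ℤ.*_) (coe h))) (cong (-1ℤ ℤ.*_) (lcVec-map-* lcg≢0 (coe h)))) ⟩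
    lc h ℤ.* lcVec (coe g) ℤ.+ -1ℤ ℤ.* (lc g ℤ.* lcVec (coe h))
      ≡⟨ cong₂ (λ a b → lc h ℤ.* a ℤ.+ -1ℤ ℤ.* (lc g ℤ.* b)) (lc≡lcVec g eqg) (lc≡lcVec h eqh) ⟨
    lc h ℤ.* lc g ℤ.+ -1ℤ ℤ.* (lc g ℤ.* lc h)
      ≡⟨ commutator (lc g) (lc h) ⟩
    0ℤ ∎
    where
    open ≡-Reasoning
    commutator : ∀ a b → b ℤ.* a ℤ.+ -1ℤ ℤ.* (a ℤ.* b) ≡ 0ℤ
    commutator = ℤ-solve

coeff-suc-const : ∀ (f : LinPoly d) → lv f ≡ 0 → ∀ i → coeff f (suc i) ≡ 0ℤ
coeff-suc-const f eq i = trans (cong (λ v → lookup v i) (lvVec≡0⇒≡replicate (coe f) eq))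
                               (VecP.lookup-replicate i 0ℤ)

Spol-const : ∀ (g h : LinPoly d) → lv g ≡ 0 → lv h ≡ 0 → Spol g h ≡ 0P
Spol-const g h eqg eqh = coeff-injective λ i →
  trans (coeff-Spol g h i) (trans (vanish i) (sym (coeff-0P i)))
  where
  commutator : ∀ a b → b ℤ.* a ℤ.- a ℤ.* b ≡ 0ℤ
  commutator = ℤ-solve
  annihilate : ∀ a b → b ℤ.* 0ℤ ℤ.- a ℤ.* 0ℤ ≡ 0ℤ
  annihilate = ℤ-solve
  vanish : ∀ i → lc h ℤ.* coeff g i ℤ.- lc g ℤ.* coeff h i ≡ 0ℤ
  vanish zero    rewrite lc≡cst g eqg | lc≡cst h eqh = commutator (cst g) (cst h)
  vanish (suc i) rewrite coeff-suc-const g eqg i | coeff-suc-const h eqh i = annihilate (lc g) (lc h)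

data SpolLevel (g h : LinPoly d) : Set where
  vanishes : lv h ≡ 0 → Spol g h ≡ 0P → SpolLevel g h
  drops    : lv h ≡ suc k → lv (Spol g h) ≤ k → SpolLevel g h

spolLevel : ∀ (g h : LinPoly d) → lv g ≡ lv h → SpolLevel g h
spolLevel g h eq with lv h in eqh
... | zero  = vanishes eqh (Spol-const g h eq eqh)
... | suc _ = drops eqh (lv-Spol-< g h eq eqh)

maxAbs : ℕ → Vec ℤ n → ℕ
maxAbs = Vec.foldr (λ _ → ℕ) (λ a r → ∣ a ∣ ⊔ r)

seed≤maxAbs : ∀ c (v : Vec ℤ n) → c ≤ maxAbs c v
seed≤maxAbs c []      = ℕP.≤-refl
seed≤maxAbs c (a ∷ v) = ℕP.≤-trans (seed≤maxAbs c v) (ℕP.m≤n⊔m ∣ a ∣ _)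

∣lookup∣≤maxAbs : ∀ c (v : Vec ℤ n) i → ∣ lookup v i ∣ ≤ maxAbs c v
∣lookup∣≤maxAbs c (a ∷ v) zero    = ℕP.m≤m⊔n ∣ a ∣ _
∣lookup∣≤maxAbs c (a ∷ v) (suc i) = ℕP.≤-trans (∣lookup∣≤maxAbs c v i) (ℕP.m≤n⊔m ∣ a ∣ _)

∣lcVec∣≤maxAbs : ∀ c (v : Vec ℤ n) → ∣ lcVec v ∣ ≤ maxAbs c v
∣lcVec∣≤maxAbs c []      = z≤n
∣lcVec∣≤maxAbs c (a ∷ v) with lvVec v
... | zero  = ℕP.m≤m⊔n ∣ a ∣ _
... | suc _ = ℕP.≤-trans (∣lcVec∣≤maxAbs c v) (ℕP.m≤n⊔m ∣ a ∣ _)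

maxAbs-lub : ∀ {c B} (v : Vec ℤ n) → c ≤ B → (∀ i → ∣ lookup v i ∣ ≤ B) → maxAbs c v ≤ B
maxAbs-lub []      c≤B _  = c≤B
maxAbs-lub (a ∷ v) c≤B v≤B = ℕP.⊔-lub (v≤B zero) (maxAbs-lub v c≤B (v≤B ∘ suc))

∣coeff∣≤normP : ∀ (f : LinPoly d) i → ∣ coeff f i ∣ ≤ normP f
∣coeff∣≤normP f zero    = seed≤maxAbs ∣ cst f ∣ (coe f)
∣coeff∣≤normP f (suc i) = ∣lookup∣≤maxAbs ∣ cst f ∣ (coe f) i

normP-lub : ∀ (f : LinPoly d) {B} → (∀ i → ∣ coeff f i ∣ ≤ B) → normP f ≤ B
normP-lub f f≤B = maxAbs-lub (coe f) (f≤B zero) (f≤B ∘ suc)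

∣lc∣≤normP : ∀ (f : LinPoly d) → ∣ lc f ∣ ≤ normP f
∣lc∣≤normP f with lv f
... | zero  = seed≤maxAbs ∣ cst f ∣ (coe f)
... | suc _ = ∣lcVec∣≤maxAbs ∣ cst f ∣ (coe f)

normP-0P : normP (0P {d}) ≡ 0
normP-0P {d} = ℕP.n≤0⇒n≡0 (normP-lub (0P {d}) (λ i → ℕP.≤-reflexive (cong ∣_∣ (coeff-0P i))))

normP≤normL : ∀ {f : LinPoly d} {X} → f ∈ X → normP f ≤ normL X
normP≤normL {X = g ∷ X} (here refl) = ℕP.m≤m⊔n (normP g) _
normP≤normL {X = g ∷ X} (there f∈X) = ℕP.≤-trans (normP≤normL f∈X) (ℕP.m≤n⊔m (normP g) _)

normP-Spol : ∀ (g h : LinPoly d) → normP (Spol g h) ≤ ∣ lc h ∣ * normP g + ∣ lc g ∣ * normP h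
normP-Spol g h = normP-lub (Spol g h) λ i → begin
  ∣ coeff (Spol g h) i ∣
    ≡⟨ cong ∣_∣ (coeff-Spol g h i) ⟩
  ∣ lc h ℤ.* coeff g i ℤ.- lc g ℤ.* coeff h i ∣
    ≤⟨ ℤP.∣i-j∣≤∣i∣+∣j∣ (lc h ℤ.* coeff g i) (lc g ℤ.* coeff h i) ⟩
  ∣ lc h ℤ.* coeff g i ∣ + ∣ lc g ℤ.* coeff h i ∣
    ≡⟨ cong₂ _+_ (ℤP.abs-* (lc h) (coeff g i)) (ℤP.abs-* (lc g) (coeff h i)) ⟩
  ∣ lc h ∣ * ∣ coeff g i ∣ + ∣ lc g ∣ * ∣ coeff h i ∣
    ≤⟨ ℕP.+-mono-≤ (ℕP.*-monoʳ-≤ ∣ lc h ∣ (∣coeff∣≤normP g i)) (ℕP.*-monoʳ-≤ ∣ lc g ∣ (∣coeff∣≤normP h i)) ⟩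
  ∣ lc h ∣ * normP g + ∣ lc g ∣ * normP h ∎
  where open ℕP.≤-Reasoning

n≤2^⌈log₂n⌉ : ∀ n → n ≤ 2 ^ ⌈log₂ n ⌉
n≤2^⌈log₂n⌉ n = go n _
  where
  go : ∀ n (rec : Acc _<_ n) → n ≤ 2 ^ ⌈log2⌉ n rec
  go zero                _        = z≤n
  go (suc zero)          _        = s≤s z≤n
  go (suc (suc n)) (acc _)  = ℕP.≤-trans n+2≤2[1+⌈n/2⌉] (ℕP.*-monoʳ-≤ 2 (go (suc ℕ.⌈ n /2⌉) _))
    where
    n≤2⌈n/2⌉ : n ≤ ℕ.⌈ n /2⌉ + ℕ.⌈ n /2⌉
    n≤2⌈n/2⌉ = subst (_≤ ℕ.⌈ n /2⌉ + ℕ.⌈ n /2⌉) (ℕP.⌊n/2⌋+⌈n/2⌉≡n n)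
                     (ℕP.+-monoˡ-≤ ℕ.⌈ n /2⌉ (ℕP.⌊n/2⌋≤⌈n/2⌉ n))
    n+2≤2[1+⌈n/2⌉] : suc (suc n) ≤ 2 * suc ℕ.⌈ n /2⌉
    n+2≤2[1+⌈n/2⌉] = subst (suc (suc n) ≤_) (double (ℕ.⌈ n /2⌉)) (s≤s (s≤s n≤2⌈n/2⌉))
      where
      double : ∀ m → suc (suc (m + m)) ≡ 2 * suc m
      double = ℕ-solve

m*n^k+1≤[m+1]*[n+1]^k : ∀ m n k → m * n ^ k + 1 ≤ (m + 1) * (n + 1) ^ k
m*n^k+1≤[m+1]*[n+1]^k m n k = begin
  m * n ^ k + 1             ≤⟨ ℕP.+-mono-≤ (ℕP.*-monoʳ-≤ m (ℕP.^-monoˡ-≤ k (ℕP.m≤m+n n 1))) 1≤[n+1]^k ⟩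
  m * (n + 1) ^ k + (n + 1) ^ k ≡⟨ distrib m ((n + 1) ^ k) ⟩
  (m + 1) * (n + 1) ^ k     ∎
  where
  open ℕP.≤-Reasoning
  1≤[n+1]^k : 1 ≤ (n + 1) ^ k
  1≤[n+1]^k rewrite ℕP.+-comm n 1 = ℕP.^-monoʳ-≤ (suc n) {0} {k} z≤n
  distrib : ∀ m p → m * p + p ≡ (m + 1) * p
  distrib = ℕ-solve

-- The bound 1 + L + (L+1)j on the bit size, where L = ⌈log₂(N+1)⌉, comes from
-- N·(2N)^j + 1 ≤ (N+1)(2N+1)^j ≤ 2^L · (2^(L+1))^j.
bitsize-bound : ∀ N j {X} → X ≤ N * (2 * N) ^ j → ⟨ X ⟩ ≤ (j + 2) * (⟨ N ⟩ + 1)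
bitsize-bound N j {X} X≤ = begin
  1 + ⌈log₂ (X + 1) ⌉              ≤⟨ s≤s log-bound ⟩
  1 + (L + suc L * j)             ≤⟨ ℕP.m≤m+n _ (j + L + 3) ⟩
  1 + (L + suc L * j) + (j + L + 3) ≡⟨ expand j L ⟩
  (j + 2) * ((1 + L) + 1)         ∎
  where
  open ℕP.≤-Reasoning
  L : ℕ
  L = ⌈log₂ (N + 1) ⌉
  N+1≤2^L : N + 1 ≤ 2 ^ L
  N+1≤2^L = n≤2^⌈log₂n⌉ (N + 1)
  2N+1≤2^[1+L] : 2 * N + 1 ≤ 2 ^ suc L
  2N+1≤2^[1+L] = begin
    2 * N + 1         ≤⟨ ℕP.n≤1+n _ ⟩
    suc (2 * N + 1)   ≡⟨ twice N ⟩
    2 * (N + 1)       ≤⟨ ℕP.*-monoʳ-≤ 2 N+1≤2^L ⟩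
    2 ^ suc L         ∎
    where
    twice : ∀ N → suc (2 * N + 1) ≡ 2 * (N + 1)
    twice = ℕ-solve
  X+1≤2^[L+[1+L]j] : X + 1 ≤ 2 ^ (L + suc L * j)
  X+1≤2^[L+[1+L]j] = begin
    X + 1                          ≤⟨ ℕP.+-monoˡ-≤ 1 X≤ ⟩
    N * (2 * N) ^ j + 1            ≤⟨ m*n^k+1≤[m+1]*[n+1]^k N (2 * N) j ⟩
    (N + 1) * (2 * N + 1) ^ j      ≤⟨ ℕP.*-mono-≤ N+1≤2^L (ℕP.^-monoˡ-≤ j 2N+1≤2^[1+L]) ⟩
    2 ^ L * (2 ^ suc L) ^ j        ≡⟨ cong (2 ^ L *_) (ℕP.^-*-assoc 2 (suc L) j) ⟩
    2 ^ L * 2 ^ (suc L * j)        ≡⟨ ℕP.^-distribˡ-+-* 2 L (suc L * j) ⟨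
    2 ^ (L + suc L * j)            ∎
  log-bound : ⌈log₂ (X + 1) ⌉ ≤ L + suc L * j
  log-bound = subst (⌈log₂ (X + 1) ⌉ ≤_) (⌈log₂2^n⌉≡n (L + suc L * j)) (⌈log₂⌉-mono-≤ X+1≤2^[L+[1+L]j])
  expand : ∀ j L → 1 + (L + suc L * j) + (j + L + 3) ≡ (j + 2) * ((1 + L) + 1)
  expand = ℕ-solve

suc+≤ : ∀ {i j k m} → i + suc k ≤ m → j ≤ k → suc i + j ≤ m
suc+≤ {i} {j} {k} {m} i+1+k≤m j≤k =
  ℕP.≤-trans (ℕP.+-monoʳ-≤ (suc i) j≤k) (subst (_≤ m) (ℕP.+-suc i k) i+1+k≤m)

module _ (Φ : System d) where

  rhs∈terms : ∀ {f g} → (f , g) ∈ Φ → g ∈ terms Φ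
  rhs∈terms = ∈-concatMap⁺ _ ∘ Any.map λ { refl → there (here refl) }

  NormBounded : LinPoly d → Set
  NormBounded h = ∃[ j ] (j + lv h ≤ d × normP h ≤ normΦ Φ * (2 * normΦ Φ) ^ j)

  0P-normBounded : NormBounded 0P
  0P-normBounded = d , ℕP.≤-reflexive (trans (cong (d +_) (lv-0P {d})) (ℕP.+-identityʳ d)) ,
                   ℕP.≤-trans (ℕP.≤-reflexive (normP-0P {d})) z≤n

  Δf-normBounded : ∀ {f h} → Δf Φ f h → NormBounded h
  Δf-normBounded {h = h} (base h∈) =
    0 , lv≤ h , ℕP.≤-trans (normP≤normL h∈) (ℕP.≤-reflexive (sym (ℕP.*-identityʳ (normΦ Φ))))
  Δf-normBounded (step {g} {h} g∈ D eq) with Δf-normBounded D | spolLevel g h eq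
  ... | _ | vanishes _ S≡0 = subst NormBounded (sym S≡0) 0P-normBounded
  ... | j , j+lvh≤d , h≤ | drops {k} lvh≡1+k S≤k = suc j , level , norm
    where
    N : ℕ
    N = normΦ Φ
    g≤N : normP g ≤ N
    g≤N = normP≤normL (rhs∈terms g∈)
    level : suc j + lv (Spol g h) ≤ d
    level = suc+≤ (subst (λ l → j + l ≤ d) lvh≡1+k j+lvh≤d) S≤k
    norm : normP (Spol g h) ≤ N * (2 * N) ^ suc j
    norm = begin
      normP (Spol g h)                    ≤⟨ normP-Spol g h ⟩
      ∣ lc h ∣ * normP g + ∣ lc g ∣ * normP h
        ≤⟨ ℕP.+-mono-≤ (ℕP.*-mono-≤ (ℕP.≤-trans (∣lc∣≤normP h) h≤) g≤N)
                       (ℕP.*-mono-≤ (ℕP.≤-trans (∣lc∣≤normP g) g≤N) h≤) ⟩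
      N * (2 * N) ^ j * N + N * (N * (2 * N) ^ j) ≡⟨ regroup N ((2 * N) ^ j) ⟩
      N * (2 * N) ^ suc j                 ∎
      where
      open ℕP.≤-Reasoning
      regroup : ∀ N P → N * P * N + N * (N * P) ≡ N * (2 * N * P)
      regroup = ℕ-solve

  Δ-bitsize : ∀ h → Δ Φ h → ⟨ normP h ⟩ ≤ (d + 2) * (⟨ normΦ Φ ⟩ + 1)
  Δ-bitsize h (_ , _ , D) with Δf-normBounded D
  ... | j , j+lvh≤d , h≤ = ℕP.≤-trans (bitsize-bound (normΦ Φ) j h≤)
    (ℕP.*-monoˡ-≤ (⟨ normΦ Φ ⟩ + 1) (ℕP.+-monoˡ-≤ 2 (ℕP.≤-trans (ℕP.m≤m+n j (lv h)) j+lvh≤d)))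

_≟P_ : DecidableEquality (LinPoly d)
lin u a ≟P lin v b = map′ (λ (u≡v , a≡b) → cong₂ lin u≡v a≡b) (λ { refl → refl , refl })
                          (VecP.≡-dec ℤ._≟_ u v ×-dec (a ℤ.≟ b))

insert : ℤ × LinPoly d → List (ℤ × LinPoly d) → List (ℤ × LinPoly d)
insert (c , p) []                = (c , p) ∷ []
insert (c , p) ((c′ , p′) ∷ L) with p ≟P p′
... | yes _ = (c ℤ.+ c′ , p′) ∷ L
... | no _  = (c′ , p′) ∷ insert (c , p) L

dedup : List (ℤ × LinPoly d) → List (ℤ × LinPoly d)
dedup = List.foldr insert []

lincomb-insert : ∀ c (p : LinPoly d) L → lincomb (insert (c , p) L) ≡ (c ·P p) +P lincomb L
lincomb-insert c p []               = refl
lincomb-insert c p ((c′ , p′) ∷ L) with p ≟P p′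
... | yes refl = begin
  ((c ℤ.+ c′) ·P p) +P lincomb L          ≡⟨ cong (_+P lincomb L) (·P-distribʳ-+ c c′ p) ⟩
  ((c ·P p) +P (c′ ·P p)) +P lincomb L    ≡⟨ +P-assoc (c ·P p) (c′ ·P p) (lincomb L) ⟩
  (c ·P p) +P ((c′ ·P p) +P lincomb L)    ∎
  where open ≡-Reasoning
... | no _ = begin
  (c′ ·P p′) +P lincomb (insert (c , p) L)  ≡⟨ cong ((c′ ·P p′) +P_) (lincomb-insert c p L) ⟩
  (c′ ·P p′) +P ((c ·P p) +P lincomb L)     ≡⟨ +P-assoc (c′ ·P p′) (c ·P p) (lincomb L) ⟨
  ((c′ ·P p′) +P (c ·P p)) +P lincomb L     ≡⟨ cong (_+P lincomb L) (+P-comm (c′ ·P p′) (c ·P p)) ⟩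
  ((c ·P p) +P (c′ ·P p′)) +P lincomb L     ≡⟨ +P-assoc (c ·P p) (c′ ·P p′) (lincomb L) ⟩
  (c ·P p) +P ((c′ ·P p′) +P lincomb L)     ∎
  where open ≡-Reasoning

lincomb-dedup : ∀ (L : List (ℤ × LinPoly d)) → lincomb (dedup L) ≡ lincomb L
lincomb-dedup []            = refl
lincomb-dedup ((c , p) ∷ L) =
  trans (lincomb-insert c p (dedup L)) (cong ((c ·P p) +P_) (lincomb-dedup L))

All-insert : ∀ {P : LinPoly d → Set} {c p} L →
  P p → All (P ∘ proj₂) L → All (P ∘ proj₂) (insert (c , p) L)
All-insert                   []               Pp []         = Pp ∷ []
All-insert {p = p} ((_ , p′) ∷ L) Pp (Pp′ ∷ PL) with p ≟P p′
... | yes _ = Pp′ ∷ PL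
... | no _  = Pp′ ∷ All-insert L Pp PL

All-dedup : ∀ {P : LinPoly d → Set} L → All (P ∘ proj₂) L → All (P ∘ proj₂) (dedup L)
All-dedup []      []         = []
All-dedup (_ ∷ L) (Pp ∷ PL) = All-insert (dedup L) Pp (All-dedup L PL)

insert-Unique : ∀ {c p} (L : List (ℤ × LinPoly d)) →
  Unique (List.map proj₂ L) → Unique (List.map proj₂ (insert (c , p) L))
insert-Unique                   []               []        = [] ∷ []
insert-Unique {p = p} ((_ , p′) ∷ L) (p′∉ ∷ uL) with p ≟P p′
... | yes _   = p′∉ ∷ uL
... | no p≢p′ =
  AllP.map⁺ (All-insert L (p≢p′ ∘ sym) (AllP.map⁻ p′∉)) ∷ insert-Unique L uL

dedup-Unique : ∀ (L : List (ℤ × LinPoly d)) → Unique (List.map proj₂ (dedup L))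
dedup-Unique []      = []
dedup-Unique (_ ∷ L) = insert-Unique (dedup L) (dedup-Unique L)

LinIndep⇒≢0P : ∀ {S : LinPoly d → Set} → LinIndep S → ∀ {g} → S g → g ≢ 0P
LinIndep⇒≢0P indep {g} Sg g≡0
  with indep ((ℤ.+ 1 , g) ∷ []) (Sg ∷ []) ([] ∷ [])
             (trans (+P-identityʳ _) (trans (·P-identityˡ g) g≡0))
... | () ∷ []

Primitive⇒IsPrimPart-self : ∀ {f : LinPoly d} → Primitive f → IsPrimPart f f
Primitive⇒IsPrimPart-self {f = f} prim@(f≢0 , content≡1) =
  f≢0 , prim , trans (sym (·P-identityˡ f)) (cong (λ c → (ℤ.+ c) ·P f) (sym content≡1))

M-Spol : ∀ {Φ : System d} {f g h} → M Φ f g → M Φ f h → M Φ f (Spol g h)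
M-Spol {g = g} {h} g∈M h∈M = add (scale (lc h) g∈M) (scale -1ℤ (scale (lc g) h∈M))

successor : System d → LinPoly d → LinPoly d → LinPoly d
successor []              f h = h
successor ((f′ , g) ∷ Ψ) f h with (f ≟P f′) ×-dec (lv g ℕ.≟ lv h)
... | yes _ = Spol g h
... | no _  = successor Ψ f h

successor≡Spol : ∀ (Ψ : System d) {f g h} → (∀ {g′} → (f , g′) ∈ Ψ → lv g′ ≡ lv h → g′ ≡ g) →
  (f , g) ∈ Ψ → lv g ≡ lv h → successor Ψ f h ≡ Spol g h
successor≡Spol ((f′ , g′) ∷ Ψ) {f} {g} {h} unique g∈ eq
  with (f ≟P f′) ×-dec (lv g′ ℕ.≟ lv h) | g∈
... | yes (refl , eq′) | _           = cong (λ q → Spol q h) (unique (here refl) eq′)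
... | no ¬match        | here refl   = ⊥-elim (¬match (refl , eq))
... | no _             | there g∈Ψ   = successor≡Spol Ψ (λ g″∈ → unique (there g″∈)) g∈Ψ eq

chain : System d → LinPoly d → LinPoly d → ℕ → LinPoly d
chain Φ f t = fold t (successor Φ f)

module _ {Φ : System d} (elim : ElimProp Φ) {f : LinPoly d} (prim : Primitive f) where

  basisAt : ∀ {g} → (f , g) ∈ Φ → ∀ k → k ≤ d →
    IsBasis (λ q → lv q ≤ k × (f , q) ∈ Φ) (λ h → M Φ f h × lv h ≤ k)
  basisAt {g} g∈ = elim f ((f , g) , g∈ , Primitive⇒IsPrimPart-self prim)

  rhs≢0P : ∀ {g} → (f , g) ∈ Φ → g ≢ 0P
  rhs≢0P {g} g∈ = LinIndep⇒≢0P (proj₁ (basisAt g∈ (lv g) (lv≤ g))) (ℕP.≤-refl , g∈)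

  rhs∈M : ∀ {g} → (f , g) ∈ Φ → M Φ f g
  rhs∈M {g} g∈ = proj₁ (proj₁ (proj₂ (basisAt g∈ (lv g) (lv≤ g))) g (ℕP.≤-refl , g∈))

  Spol∈lowerSpan : ∀ {g g′} → (f , g) ∈ Φ → (f , g′) ∈ Φ → lv g ≡ lv g′ →
    ∃[ L ] (All ((λ q → lv q < lv g × (f , q) ∈ Φ) ∘ proj₂) L × lincomb L ≡ Spol g g′)
  Spol∈lowerSpan {g} {g′} g∈ g′∈ eq with spolLevel g g′ eq
  ... | vanishes _ S≡0 = [] , [] , sym S≡0
  ... | drops {k} lvg′≡1+k S≤k
    with proj₂ (proj₂ (basisAt g∈ k (ℕP.<⇒≤ (lv≡suc⇒< g′ lvg′≡1+k))))
               (Spol g g′) (M-Spol (rhs∈M g∈) (rhs∈M g′∈) , S≤k)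
  ...   | L , L-low , L≡ = L , All.map lower L-low , L≡
    where
    lower : ∀ {q} → lv q ≤ k × (f , q) ∈ Φ → lv q < lv g × (f , q) ∈ Φ
    lower {q} (q≤k , q∈) = subst (lv q <_) (sym (trans eq lvg′≡1+k)) (s≤s q≤k) , q∈

  -- Two right-hand sides g ≠ g′ of f at the same level l would give the
  -- dependency  lc g · g′ − lc g′ · g + L = 0  with L the expansion of S(g, g′) in
  -- the basis below l, contradicting independence at level l since lc g ≠ 0.
  rhs-unique : ∀ {g g′} → (f , g) ∈ Φ → (f , g′) ∈ Φ → lv g ≡ lv g′ → g ≡ g′
  rhs-unique {g} {g′} g∈ g′∈ eq with g ≟P g′
  ... | yes g≡g′ = g≡g′
  ... | no g≢g′ with Spol∈lowerSpan g∈ g′∈ eq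
  ...   | L , L-low , L≡ = ⊥-elim (lc≢0 (rhs≢0P g∈) lcg≡0)
    where
    K : List (ℤ × LinPoly d)
    K = (lc g , g′) ∷ (ℤ.- lc g′ , g) ∷ dedup L
    dedup-low : All ((λ q → lv q < lv g × (f , q) ∈ Φ) ∘ proj₂) (dedup L)
    dedup-low = All-dedup L L-low
    K-basis : All ((λ q → lv q ≤ lv g × (f , q) ∈ Φ) ∘ proj₂) K
    K-basis = (ℕP.≤-reflexive (sym eq) , g′∈) ∷ (ℕP.≤-refl , g∈)
            ∷ All.map (λ (q<g , q∈) → ℕP.<⇒≤ q<g , q∈) dedup-low
    distinct-from-low : ∀ {x} → lv x ≡ lv g → All (x ≢_) (List.map proj₂ (dedup L))
    distinct-from-low lvx≡ = AllP.map⁺ (All.map (λ (q<g , _) x≡q → ℕP.<⇒≢ q<g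
                                          (trans (cong lv (sym x≡q)) lvx≡)) dedup-low)
    K-unique : Unique (List.map proj₂ K)
    K-unique = ((g≢g′ ∘ sym) ∷ distinct-from-low (sym eq)) ∷ distinct-from-low refl ∷ dedup-Unique L
    K≡0 : lincomb K ≡ 0P
    K≡0 = trans (cong (λ r → (lc g ·P g′) +P (((ℤ.- lc g′) ·P g) +P r)) (trans (lincomb-dedup L) L≡))
                (Spol-cancels g g′)
    lcg≡0 : lc g ≡ 0ℤ
    lcg≡0 = All.head (proj₁ (basisAt g∈ (lv g) (lv≤ g)) K K-basis K-unique K≡0)

  -- The right disjunct covers the final step from a constant to 0P, after which the chain is stationary.
  OnChain : LinPoly d → Set
  OnChain h = ∃[ t ] (t ∈ terms Φ × ∃[ i ] (h ≡ chain Φ f t i ×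
                (i + lv h ≤ d ⊎ (h ≡ 0P × i ≤ suc d))))

  Δf-onChain : ∀ {h} → Δf Φ f h → OnChain h
  Δf-onChain {h} (base h∈) = h , h∈ , 0 , refl , inj₁ (lv≤ h)
  Δf-onChain (step {g} {h} g∈ D eq) with Δf-onChain D
  ... | t , t∈ , i , h≡ , bound = t , t∈ , advance (spolLevel g h eq) bound
    where
    S≡next : Spol g h ≡ chain Φ f t (suc i)
    S≡next = sym (trans (cong (successor Φ f) (sym h≡))
                   (successor≡Spol Φ (λ g′∈ e → rhs-unique g′∈ g∈ (trans e (sym eq))) g∈ eq))
    advance : SpolLevel g h → i + lv h ≤ d ⊎ (h ≡ 0P × i ≤ suc d) →
      ∃[ j ] (Spol g h ≡ chain Φ f t j × (j + lv (Spol g h) ≤ d ⊎ (Spol g h ≡ 0P × j ≤ suc d)))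
    advance (vanishes _ S≡0) (inj₁ i+lvh≤d)    =
      suc i , S≡next , inj₂ (S≡0 , s≤s (ℕP.≤-trans (ℕP.m≤m+n i (lv h)) i+lvh≤d))
    advance (vanishes _ S≡0) (inj₂ (h≡0 , i≤)) = i , trans S≡0 (trans (sym h≡0) h≡) , inj₂ (S≡0 , i≤)
    advance (drops lvh≡1+k S≤k) (inj₁ i+lvh≤d) =
      suc i , S≡next , inj₁ (suc+≤ (subst (λ l → i + l ≤ d) lvh≡1+k i+lvh≤d) S≤k)
    advance (drops lvh≡1+k _) (inj₂ (h≡0 , _)) =
      ⊥-elim (ℕP.0≢1+n (trans (sym (trans (cong lv h≡0) (lv-0P {d}))) lvh≡1+k))

∈-applyUpTo : ∀ {A : Set} (F : ℕ → A) {i n} → i < n → F i ∈ applyUpTo F n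
∈-applyUpTo F {zero}  (s≤s _)   = here refl
∈-applyUpTo F {suc i} (s≤s i<n) = there (∈-applyUpTo (F ∘ suc) i<n)

length-concatMap-const : ∀ {A B : Set} (F : A → List B) {c} → (∀ x → length (F x) ≡ c) →
  ∀ xs → length (concatMap F xs) ≡ length xs * c
length-concatMap-const F F≡c []       = refl
length-concatMap-const F F≡c (x ∷ xs) =
  trans (ListP.length-++ (F x)) (cong₂ _+_ (F≡c x) (length-concatMap-const F F≡c xs))

chains : (Φ : System d) → LinPoly d × LinPoly d → List (LinPoly d)
chains {d} Φ (f , _) = concatMap (λ t → applyUpTo (chain Φ f t) (2 + d)) (terms Φ)

candidates : System d → List (LinPoly d)
candidates Φ = concatMap (chains Φ) Φ

length-candidates : ∀ (Φ : System d) → length (candidates Φ) ≡ 2 * (length Φ * length Φ) * (d + 2)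
length-candidates {d} Φ = begin
  length (candidates Φ)                       ≡⟨ length-concatMap-const _ per-pair Φ ⟩
  m * (length (terms Φ) * (2 + d))            ≡⟨ cong (λ n → m * (n * (2 + d))) length-terms ⟩
  m * (m * 2 * (2 + d))                       ≡⟨ regroup m d ⟩
  2 * (m * m) * (d + 2)                       ∎
  where
  open ≡-Reasoning
  m : ℕ
  m = length Φ
  length-terms : length (terms Φ) ≡ m * 2
  length-terms = length-concatMap-const (λ p → proj₁ p ∷ proj₂ p ∷ []) (λ _ → refl) Φ
  per-pair : ∀ p → length (chains Φ p) ≡ length (terms Φ) * (2 + d)
  per-pair (f , _) = length-concatMap-const (λ t → applyUpTo (chain Φ f t) (2 + d))
                       (λ t → ListP.length-applyUpTo (chain Φ f t) (2 + d)) (terms Φ)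
  regroup : ∀ m d → m * (m * 2 * (2 + d)) ≡ 2 * (m * m) * (d + 2)
  regroup = ℕ-solve

chain∈candidates : ∀ {Φ : System d} {f g t i} → (f , g) ∈ Φ → t ∈ terms Φ → i < 2 + d →
  chain Φ f t i ∈ candidates Φ
chain∈candidates {d} {Φ} {f} {g} {t} {i} p∈ t∈ i<2+d =
  ∈-concatMap⁺ (chains Φ) {xs = Φ} (Any.map (λ { refl → in-chains }) p∈)
  where
  in-chains : chain Φ f t i ∈ chains Φ (f , g)
  in-chains = ∈-concatMap⁺ (λ t → applyUpTo (chain Φ f t) (2 + d))
                (Any.map (λ { refl → ∈-applyUpTo (chain Φ f t) i<2+d }) t∈)

Δ⊆candidates : ∀ {Φ : System d} → ElimProp Φ → ∀ h → Δ Φ h → h ∈ candidates Φ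
Δ⊆candidates {d} {Φ} elim h (f , (_ , _ , (_ , prim , _)) , D) = along D
  where
  along : ∀ {h} → Δf Φ f h → h ∈ candidates Φ
  along (base h∈) with find (∈-concatMap⁻ (λ p → proj₁ p ∷ proj₂ p ∷ []) {xs = Φ} h∈)
  ... | _ , p∈ , _ = chain∈candidates p∈ h∈ (s≤s z≤n)
  along S@(step g∈ _ _) with Δf-onChain elim prim S
  ... | t , t∈ , i , h≡ , bound =
    subst (_∈ candidates Φ) (sym h≡) (chain∈candidates g∈ t∈ i<2+d)
    where
    i<2+d : i < 2 + d
    i<2+d = [ (λ i+l≤d → s≤s (ℕP.≤-trans (ℕP.m≤m+n i _) (ℕP.≤-trans i+l≤d (ℕP.n≤1+n d))))
            , (λ (_ , i≤1+d) → s≤s i≤1+d) ] bound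

lemma15 : (d : ℕ) (Φ : System d) → WellFormed Φ → ElimProp Φ →
    (∃[ L ] (length L ≤ 2 * (length Φ * length Φ) * (d + 2) × (∀ h → Δ Φ h → h ∈ L)))
    × (∀ h → Δ Φ h → ⟨ normP h ⟩ ≤ (d + 2) * (⟨ normΦ Φ ⟩ + 1))
lemma15 d Φ _ elim =
  (candidates Φ , ℕP.≤-reflexive (length-candidates Φ) , Δ⊆candidates elim) , Δ-bitsize Φ
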